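{- Let $I$ be a finite set. For every composition $F$ of $I$, the function $\check{\mathtt c}_F$ on adjoint chambers satisfies the Steinmann relations. More generally, for every preposet $p$ of $I$, the function $\check{\mathtt c}_p$ satisfies the Steinmann relations.
   Context: $\mathrm T^\vee_I=\{h\in\mathbb R^I:\sum_i h_i=0\}$; for nonempty proper $A\subset I$, $\mathcal H_{(A|I\setminus A)}=\{h:\sum_{i\in A}h_i=0\}$ (special hyperplanes). The adjoint face of $h$ is the set of $h'$ for which each $\sum_{i\in A}h'_i$ ($A$ nonempty proper) has the same sign as for $h$; adjoint chambers are faces of full dimension $|I|-1$. A preposet $p$ of $I$ is identified with the set of pairs $(i_1,i_2)$, $i_1\ne i_2$, with $i_1\ge_p i_2$; a composition $F$ of $I$ (sequence of nonempty disjoint subsets with union $I$) is the preposet with $(i_1,i_2)\in F$ iff the lump of $i_1$ is equal to or left of the lump of $i_2$. $\sigma^\vee_p$ is the closed cone generated by the coroots $e_{i_1}-e_{i_2}$, $(i_1,i_2)\in p$ (a tangent cone of a generalized permutohedron), and $\check{\mathtt c}_p$ is the function on adjoint chambers equal to $1$ on chambers contained in $\sigma^\vee_p$ and $0$ otherwise. Steinmann relations: a function $f$ on adjoint chambers of $I$ satisfies them if for all ordered partitions $(S,T),(U,V)$ of $I$ into two nonempty sets such that $S\cap U,S\cap V,T\cap U,T\cap V$ are all nonempty, and every adjoint face $Y$ whose linear span is $\mathcal H_{(S|T)}\cap\mathcal H_{(U|V)}$, one has $f(X_{++})-f(X_{+- })-f(X_{ -+})+f(X_{ -- })=0$, where $X_{\epsilon\delta}$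 is the unique chamber having $Y$ in its closure on which $\sum_{i\in S}h_i$ has sign $\epsilon$ and $\sum_{i\in U}h_i$ has sign $\delta$.
   Formalization: Points of $\mathrm T^\vee_I$ have rational rather than real coordinates, so adjoint faces, their closures and linear spans, and the cone $\sigma^\vee_p$ are taken over ℚ. -}

module Defs where

open import Data.Nat using (ℕ; zero; suc)
open import Data.Fin using (Fin; zero; suc) renaming (_≤_ to _≤ᶠ_; _≟_ to _≟ᶠ_)
open import Data.Fin.Subset using (Subset; Nonempty; ∁; _∩_; _∈_)
open import Data.Vec using (lookup)
open import Data.Bool using (Bool; true; false; if_then_else_)
open import Data.Integer using (ℤ; +0; +[1+_]; -[1+_])
open import Data.Rational using (ℚ; 0ℚ; 1ℚ; _+_; _*_; _-_; _≤_; ↥_)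
open import Data.List using (List; length)
import Data.List as L
open import Data.List.Relation.Unary.All using (All)
open import Data.Product using (Σ; ∃; _×_; _,_)
open import Data.Sum using (_⊎_)
open import Relation.Binary.PropositionalEquality using (_≡_; _≢_)
open import Relation.Nullary using (¬_)
open import Relation.Nullary.Decidable using (⌊_⌋)
open import Function.Bundles using (_⇔_)
open import Data.Empty using (⊥)

-- The finite set I is Fin n; points of ℝ^I are modelled by rational points Fin n → ℚ.
Pt : ℕ → Set
Pt n = Fin n → ℚ

ΣF : (k : ℕ) → (Fin k → ℚ) → ℚ
ΣF zero    f = 0ℚ
ΣF (suc k) f = f zero + ΣF k (λ j → f (suc j))

sumOn : ∀ {n} → Subset n → Pt n → ℚ
sumOn {n} A h = ΣF n (λ i → if lookup A i then h i else 0ℚ)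

InT : ∀ {n} → Pt n → Set
InT {n} h = ΣF n h ≡ 0ℚ

NP : ∀ {n} → Subset n → Set
NP A = Nonempty A × Nonempty (∁ A)

data Sgn : Set where
  pos neg zer : Sgn

sgn : ℚ → Sgn
sgn q with ↥ q
... | +0 = zer
... | +[1+ _ ] = pos
... | -[1+ _ ] = neg

-- A (candidate) adjoint face is represented by its sign vector on subsets
-- (only values on nonempty proper subsets matter).
SignVec : ℕ → Set
SignVec n = Subset n → Sgn

InFace : ∀ {n} → SignVec n → Pt n → Set
InFace s h = InT h × (∀ A → NP A → sgn (sumOn A h) ≡ s A)

IsFace : ∀ {n} → SignVec n → Set
IsFace {n} s = Σ (Pt n) (InFace s)

IsChamber : ∀ {n} → SignVec n → Set
IsChamber s = IsFace s × (∀ A → NP A → s A ≢ zer)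

InClosure : ∀ {n} → SignVec n → Pt n → Set
InClosure s h = InT h × (∀ A → NP A → (sgn (sumOn A h) ≡ zer) ⊎ (sgn (sumOn A h) ≡ s A))

InClosureOf : ∀ {n} → SignVec n → SignVec n → Set
InClosureOf {n} Y X = ∀ (h : Pt n) → InFace Y h → InClosure X h

InSpan : ∀ {n} → SignVec n → Pt n → Set
InSpan {n} Y h =
  Σ ℕ λ k → Σ (Fin k → Pt n) λ ys → Σ (Fin k → ℚ) λ cs →
    (∀ j → InFace Y (ys j)) × (∀ i → h i ≡ ΣF k (λ j → cs j * ys j i))

SpanIsHH : ∀ {n} → SignVec n → Subset n → Subset n → Set
SpanIsHH {n} Y S U =
  ∀ (h : Pt n) → InSpan Y h ⇔ (InT h × sumOn S h ≡ 0ℚ × sumOn U h ≡ 0ℚ)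

Steinmann : ∀ {n} → (SignVec n → ℤ) → Set
Steinmann {n} f =
  ∀ (S U : Subset n) →
  Nonempty (S ∩ U) → Nonempty (S ∩ ∁ U) → Nonempty (∁ S ∩ U) → Nonempty (∁ S ∩ ∁ U) →
  ∀ (Y : SignVec n) → IsFace Y → SpanIsHH Y S U →
  ∀ (Xpp Xpm Xmp Xmm : SignVec n) →
  IsChamber Xpp → IsChamber Xpm → IsChamber Xmp → IsChamber Xmm →
  InClosureOf Y Xpp → InClosureOf Y Xpm → InClosureOf Y Xmp → InClosureOf Y Xmm →
  Xpp S ≡ pos → Xpp U ≡ pos →
  Xpm S ≡ pos → Xpm U ≡ neg →
  Xmp S ≡ neg → Xmp U ≡ pos →
  Xmm S ≡ neg → Xmm U ≡ neg →
  ((f Xpp Data.Integer.- f Xpm) Data.Integer.- f Xmp) Data.Integer.+ f Xmm ≡ +0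

-- relations on I; R i₁ i₂ means i₁ ≥ i₂
Rel : ℕ → Set₁
Rel n = Fin n → Fin n → Set

record Preposet (n : ℕ) : Set₁ where
  field
    _≽_    : Rel n
    refl′  : ∀ i → i ≽ i
    trans′ : ∀ {i j k} → i ≽ j → j ≽ k → i ≽ k

δ : ∀ {n} → Fin n → Fin n → ℚ
δ a i = if ⌊ a ≟ᶠ i ⌋ then 1ℚ else 0ℚ

InCone : ∀ {n} → Rel n → Pt n → Set
InCone {n} R h =
  Σ ℕ λ k → Σ (Fin k → Fin n) λ a → Σ (Fin k → Fin n) λ b → Σ (Fin k → ℚ) λ c →
    (∀ j → R (a j) (b j) × a j ≢ b j × 0ℚ ≤ c j) ×
    (∀ i → h i ≡ ΣF k (λ j → c j * (δ (a j) i - δ (b j) i)))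

ChamberInCone : ∀ {n} → Rel n → SignVec n → Set
ChamberInCone {n} R X = ∀ (h : Pt n) → InFace X h → InCone R h

IsCheckC : ∀ {n} → Rel n → (SignVec n → ℤ) → Set
IsCheckC R v =
  ∀ X → IsChamber X →
    (ChamberInCone R X → v X ≡ +[1+ 0 ]) × (¬ ChamberInCone R X → v X ≡ +0)

record Composition (n : ℕ) : Set where
  field
    lumps    : List (Subset n)
    nonempty : All Nonempty lumps
    disjoint : ∀ (a b : Fin (length lumps)) → a ≢ b →
               ∀ i → i ∈ L.lookup lumps a → i ∈ L.lookup lumps b → ⊥
    covers   : ∀ i → Σ (Fin (length lumps)) λ a → i ∈ L.lookup lumps a

compRel : ∀ {n} → Composition n → Rel n
compRel F i₁ i₂ =
  Σ (Fin (length lumps)) λ a → Σ (Fin (length lumps)) λ b →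
    a ≤ᶠ b × i₁ ∈ L.lookup lumps a × i₂ ∈ L.lookup lumps b
  where open Composition F

-- Gale's supply–demand theorem identifies σ^∨_p with the vectors of T^∨_I whose sum over every
-- upper set of p is nonnegative, so a chamber lies in σ^∨_p iff it is positive on every nonempty
-- proper upper set. Let Y span H_(S|T) ∩ H_(U|V). The only nonempty proper sets whose sums vanish
-- on that plane are S, T, U and V, so the four chambers X_εδ around Y agree on every other set,
-- while on S, T, U, V their signs are prescribed by ε and δ. If neither S nor T is an upper set,
-- č_p does not see ε and the alternating sum cancels in pairs; likewise for U, V and δ. If
-- A ∈ {S, T} and B ∈ {U, V} are both upper sets, then so are A ∩ B and A ∪ B, whose sums add up
-- to 0 on Y; positivity of a chamber around Y would make the quadrant A ∩ B vanish on the plane,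
-- which it does not, so all four values are 0.

module Submission where

open import Defs
open import Data.Nat using (ℕ)
open import Data.Integer using (ℤ)
open import Data.Product using (_×_)

open import Data.Nat using (zero; suc) renaming (_*_ to _*ℕ_)
open import Data.Bool using (Bool; true; false; not; _∧_; _∨_; if_then_else_)
import Data.Bool.Properties as BoolP
open import Data.Fin using (Fin; zero; suc; combine; remQuot)
import Data.Fin.Properties as FinP
open import Data.Fin.Subset using (Subset; Nonempty; ∁; _∩_; _∪_; _∈_; _∉_; _⊆_; _⊂_; ⊤; ⊥)
import Data.Fin.Subset.Properties as SubP
open import Data.Fin.Subset.Induction using (⊂-wellFounded)
open import Data.Integer using (+0; +[1+_]; -[1+_]) renaming (_+_ to _+ℤ_; _-_ to _-ℤ_)
import Data.Integer.Properties as ℤP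
import Data.Integer.Solver as ℤSolver
open import Data.Rational using (ℚ; mkℚ; 0ℚ; 1ℚ; _+_; _*_; _-_; -_; _≤_; _<_; _⊓_)
import Data.Rational.Properties as ℚP
import Data.Rational.Solver as ℚSolver
open import Data.Vec using (_∷_; []; lookup; tabulate)
import Data.Vec.Properties as VecP
open import Data.Product using (∃; _,_; proj₁; proj₂; uncurry)
open import Data.Sum as Sum using (_⊎_; inj₁; inj₂)
open import Data.Empty using (⊥-elim)
open import Function using (_∘_; id)
open import Function.Bundles using (_⇔_; mk⇔; Equivalence)
open import Induction.WellFounded using (Acc; acc)
open import Algebra.Properties.Group ℚP.+-0-group using (inverseʳ-unique)
open import Relation.Binary using (IsDecPreorder)
open import Relation.Binary.Definitions using (Decidable; tri<; tri≈; tri>)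
open import Relation.Binary.PropositionalEquality
import Relation.Binary.PropositionalEquality as ≡
open import Relation.Nullary using (¬_; Dec; yes; no; ¬?; _×-dec_; _→-dec_)
open import Relation.Nullary.Decidable
  using (⌊_⌋; toWitness; fromWitness; decidable-stable; map′; ¬¬-excluded-middle)
open import Relation.Nullary.Negation using (contradiction; ¬¬-map)

-- Finite sums

ΣF-cong : ∀ k {f g : Fin k → ℚ} → (∀ i → f i ≡ g i) → ΣF k f ≡ ΣF k g
ΣF-cong zero    f≗g = refl
ΣF-cong (suc k) f≗g = cong₂ _+_ (f≗g zero) (ΣF-cong k (f≗g ∘ suc))

ΣF-0 : ∀ k → ΣF k (λ _ → 0ℚ) ≡ 0ℚ
ΣF-0 zero    = refl
ΣF-0 (suc k) = cong (0ℚ +_) (ΣF-0 k)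

ΣF-+ : ∀ k (f g : Fin k → ℚ) → ΣF k (λ i → f i + g i) ≡ ΣF k f + ΣF k g
ΣF-+ zero    f g = refl
ΣF-+ (suc k) f g = trans (cong (f zero + g zero +_) (ΣF-+ k (f ∘ suc) (g ∘ suc)))
  (interchange (f zero) (g zero) (ΣF k (f ∘ suc)) (ΣF k (g ∘ suc)))
  where
  open ℚSolver.+-*-Solver
  interchange = solve 4 (λ a b c d → (a :+ b) :+ (c :+ d) := (a :+ c) :+ (b :+ d)) refl

ΣF-- : ∀ k (f g : Fin k → ℚ) → ΣF k (λ i → f i - g i) ≡ ΣF k f - ΣF k g
ΣF-- zero    f g = refl
ΣF-- (suc k) f g = trans (cong (f zero - g zero +_) (ΣF-- k (f ∘ suc) (g ∘ suc)))
  (interchange (f zero) (g zero) (ΣF k (f ∘ suc)) (ΣF k (g ∘ suc)))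
  where
  open ℚSolver.+-*-Solver
  interchange = solve 4 (λ a b c d → (a :- b) :+ (c :- d) := (a :+ c) :- (b :+ d)) refl

ΣF-*ˡ : ∀ k c (f : Fin k → ℚ) → ΣF k (λ i → c * f i) ≡ c * ΣF k f
ΣF-*ˡ zero    c f = sym (ℚP.*-zeroʳ c)
ΣF-*ˡ (suc k) c f = trans (cong (c * f zero +_) (ΣF-*ˡ k c (f ∘ suc)))
  (sym (ℚP.*-distribˡ-+ c (f zero) (ΣF k (f ∘ suc))))

ΣF-comm : ∀ m k (F : Fin m → Fin k → ℚ) →
  ΣF m (λ i → ΣF k (F i)) ≡ ΣF k (λ j → ΣF m (λ i → F i j))
ΣF-comm zero    k F = sym (ΣF-0 k)
ΣF-comm (suc m) k F = trans (cong (ΣF k (F zero) +_) (ΣF-comm m k (F ∘ suc)))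
  (sym (ΣF-+ k (F zero) (λ j → ΣF m (λ i → F (suc i) j))))

ΣF-mono-≤ : ∀ k {f g : Fin k → ℚ} → (∀ i → f i ≤ g i) → ΣF k f ≤ ΣF k g
ΣF-mono-≤ zero    f≤g = ℚP.≤-refl
ΣF-mono-≤ (suc k) f≤g = ℚP.+-mono-≤ (f≤g zero) (ΣF-mono-≤ k (f≤g ∘ suc))

ΣF-mono-< : ∀ k {f g : Fin k → ℚ} → (∀ i → f i ≤ g i) → ∀ j → f j < g j → ΣF k f < ΣF k g
ΣF-mono-< (suc k) f≤g zero    fj<gj = ℚP.+-mono-<-≤ fj<gj (ΣF-mono-≤ k (f≤g ∘ suc))
ΣF-mono-< (suc k) f≤g (suc j) fj<gj = ℚP.+-mono-≤-< (f≤g zero) (ΣF-mono-< k (f≤g ∘ suc) j fj<gj)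

ΣF-nonneg : ∀ k {f : Fin k → ℚ} → (∀ i → 0ℚ ≤ f i) → 0ℚ ≤ ΣF k f
ΣF-nonneg k {f} f≥0 = subst (_≤ ΣF k f) (ΣF-0 k) (ΣF-mono-≤ k f≥0)

≤⇒≯ : ∀ {p q} → p ≤ q → ¬ q < p
≤⇒≯ p≤q q<p = ℚP.<-irrefl refl (ℚP.≤-<-trans p≤q q<p)

ΣF-nonneg-zero : ∀ k {f : Fin k → ℚ} → (∀ i → 0ℚ ≤ f i) → ΣF k f ≡ 0ℚ → ∀ i → f i ≡ 0ℚ
ΣF-nonneg-zero k {f} f≥0 Σf≡0 i with ℚP.<-cmp 0ℚ (f i)
... | tri< 0<fi _ _ =
  contradiction (subst₂ _<_ (ΣF-0 k) Σf≡0 (ΣF-mono-< k f≥0 i 0<fi)) (ℚP.<-irrefl refl)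
... | tri≈ _ 0≡fi _ = sym 0≡fi
... | tri> _ _ fi<0 = contradiction fi<0 (≤⇒≯ (f≥0 i))

nonneg-+-zero : ∀ {p q} → 0ℚ ≤ p → 0ℚ ≤ q → p + q ≡ 0ℚ → p ≡ 0ℚ
nonneg-+-zero {p} {q} p≥0 q≥0 p+q≡0 =
  ℚP.≤-antisym (subst (p ≤_) p+q≡0 (subst (_≤ p + q) (ℚP.+-identityʳ p) (ℚP.+-monoʳ-≤ p q≥0))) p≥0

-- Sums over subsets

𝟙 : Bool → ℚ
𝟙 b = if b then 1ℚ else 0ℚ

module _ {n : ℕ} where

  sumOn-cong : ∀ A {g h : Pt n} → (∀ x → g x ≡ h x) → sumOn A g ≡ sumOn A h
  sumOn-cong A g≗h = ΣF-cong n (λ x → cong (λ q → if lookup A x then q else 0ℚ) (g≗h x))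

  sumOn-- : ∀ A (g h : Pt n) → sumOn A (λ x → g x - h x) ≡ sumOn A g - sumOn A h
  sumOn-- A g h = trans (ΣF-cong n (λ x → pointwise (lookup A x) (g x) (h x))) (ΣF-- n _ _)
    where
    pointwise : ∀ b p q → (if b then p - q else 0ℚ) ≡ (if b then p else 0ℚ) - (if b then q else 0ℚ)
    pointwise true  p q = refl
    pointwise false p q = refl

  sumOn-*ˡ : ∀ A c (h : Pt n) → sumOn A (λ x → c * h x) ≡ c * sumOn A h
  sumOn-*ˡ A c h = trans (ΣF-cong n (λ x → pointwise (lookup A x) (h x))) (ΣF-*ˡ n c _)
    where
    pointwise : ∀ b q → (if b then c * q else 0ℚ) ≡ c * (if b then q else 0ℚ)
    pointwise true  q = refl
    pointwise false q = sym (ℚP.*-zeroʳ c)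

  sumOn-ΣF : ∀ A k (H : Fin k → Pt n) →
    sumOn A (λ x → ΣF k (λ j → H j x)) ≡ ΣF k (λ j → sumOn A (H j))
  sumOn-ΣF A k H = trans (ΣF-cong n (λ x → pointwise (lookup A x) x)) (ΣF-comm n k _)
    where
    pointwise : ∀ b x → (if b then ΣF k (λ j → H j x) else 0ℚ) ≡ ΣF k (λ j → if b then H j x else 0ℚ)
    pointwise true  x = refl
    pointwise false x = sym (ΣF-0 k)

  sumOn-⊤ : ∀ (h : Pt n) → sumOn ⊤ h ≡ ΣF n h
  sumOn-⊤ h = ΣF-cong n (λ x → cong (λ b → if b then h x else 0ℚ) (VecP.lookup-replicate x true))

  sumOn-⊥ : ∀ (h : Pt n) → sumOn ⊥ h ≡ 0ℚ
  sumOn-⊥ h = trans (ΣF-cong n (λ x → cong (λ b → if b then h x else 0ℚ) (VecP.lookup-replicate x false)))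
    (ΣF-0 n)

  sumOn-∩-∪ : ∀ A B (h : Pt n) → sumOn (A ∩ B) h + sumOn (A ∪ B) h ≡ sumOn A h + sumOn B h
  sumOn-∩-∪ A B h = begin
    sumOn (A ∩ B) h + sumOn (A ∪ B) h              ≡⟨ ΣF-+ n _ _ ⟨
    ΣF n (λ x → term (A ∩ B) x + term (A ∪ B) x)   ≡⟨ ΣF-cong n pointwise ⟩
    ΣF n (λ x → term A x + term B x)               ≡⟨ ΣF-+ n _ _ ⟩
    sumOn A h + sumOn B h                          ∎
    where
    open ≡-Reasoning
    term : Subset n → Fin n → ℚ
    term C x = if lookup C x then h x else 0ℚ
    pointwise : ∀ x → term (A ∩ B) x + term (A ∪ B) x ≡ term A x + term B x
    pointwise x rewrite VecP.lookup-zipWith _∧_ x A B | VecP.lookup-zipWith _∨_ x A B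
      with lookup A x | lookup B x
    ... | true  | true  = refl
    ... | true  | false = ℚP.+-comm 0ℚ (h x)
    ... | false | true  = refl
    ... | false | false = refl

  sumOn-∁ : ∀ A (h : Pt n) → sumOn A h + sumOn (∁ A) h ≡ ΣF n h
  sumOn-∁ A h = trans (sym (ΣF-+ n _ _)) (ΣF-cong n pointwise)
    where
    pointwise : ∀ x → (if lookup A x then h x else 0ℚ) + (if lookup (∁ A) x then h x else 0ℚ) ≡ h x
    pointwise x rewrite VecP.lookup-map x not A with lookup A x
    ... | true  = ℚP.+-identityʳ (h x)
    ... | false = ℚP.+-identityˡ (h x)

  sumOn-∁-InT : ∀ A {h : Pt n} → InT h → sumOn (∁ A) h ≡ - sumOn A h
  sumOn-∁-InT A {h} Σh≡0 = inverseʳ-unique (sumOn A h) (sumOn (∁ A) h) (trans (sumOn-∁ A h) Σh≡0)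

δ-suc : ∀ {n} (a i : Fin n) → δ (suc a) (suc i) ≡ δ a i
δ-suc a i with a FinP.≟ i
... | yes _ = refl
... | no  _ = refl

δ-diag : ∀ {n} (a : Fin n) → δ a a ≡ 1ℚ
δ-diag a with a FinP.≟ a
... | yes _   = refl
... | no  a≢a = contradiction refl a≢a

δ-off : ∀ {n} {a i : Fin n} → a ≢ i → δ a i ≡ 0ℚ
δ-off {a = a} {i} a≢i with a FinP.≟ i
... | yes a≡i = contradiction a≡i a≢i
... | no  _   = refl

if-0 : ∀ b → (if b then 0ℚ else 0ℚ) ≡ 0ℚ
if-0 true  = refl
if-0 false = refl

sumOn-δ : ∀ {n} (A : Subset n) a → sumOn A (δ a) ≡ 𝟙 (lookup A a)
sumOn-δ {suc n} (b ∷ A) zero =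
  trans (cong (𝟙 b +_) (trans (ΣF-cong n (if-0 ∘ lookup A)) (ΣF-0 n))) (ℚP.+-identityʳ (𝟙 b))
sumOn-δ {suc n} (b ∷ A) (suc a) =
  trans (cong₂ _+_ (if-0 b) (sumOn-cong A (δ-suc a))) (trans (ℚP.+-identityˡ _) (sumOn-δ A a))

ΣF-δ : ∀ {n} (a : Fin n) → ΣF n (δ a) ≡ 1ℚ
ΣF-δ a = trans (sym (sumOn-⊤ (δ a))) (trans (sumOn-δ ⊤ a) (cong 𝟙 (VecP.lookup-replicate a true)))

coroot : ∀ {n} → Fin n → Fin n → Pt n
coroot a b x = δ a x - δ b x

sumOn-coroot : ∀ {n} (A : Subset n) a b → sumOn A (coroot a b) ≡ 𝟙 (lookup A a) - 𝟙 (lookup A b)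
sumOn-coroot A a b = trans (sumOn-- A (δ a) (δ b)) (cong₂ _-_ (sumOn-δ A a) (sumOn-δ A b))

ΣF-coroot : ∀ {n} (a b : Fin n) → ΣF n (coroot a b) ≡ 0ℚ
ΣF-coroot a b = trans (ΣF-- _ (δ a) (δ b)) (trans (cong₂ _-_ (ΣF-δ a) (ΣF-δ b)) (ℚP.+-inverseʳ 1ℚ))

module _ {n : ℕ} {A : Subset n} {x : Fin n} where

  ∈⇒lookup : x ∈ A → lookup A x ≡ true
  ∈⇒lookup = VecP.[]=⇒lookup

  ∉⇒lookup : x ∉ A → lookup A x ≡ false
  ∉⇒lookup x∉A with lookup A x in eq
  ... | true  = contradiction (VecP.lookup⇒[]= x A eq) x∉A
  ... | false = refl

module _ {n : ℕ} {P : Fin n → Set} (P? : ∀ x → Dec (P x)) where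

  decSubset : Subset n
  decSubset = tabulate (⌊_⌋ ∘ P?)

  ∈-decSubset⁺ : ∀ {x} → P x → x ∈ decSubset
  ∈-decSubset⁺ {x} p =
    VecP.lookup⇒[]= x _ (trans (VecP.lookup∘tabulate _ x) (Equivalence.to BoolP.T-≡ (fromWitness p)))

  ∈-decSubset⁻ : ∀ {x} → x ∈ decSubset → P x
  ∈-decSubset⁻ {x} x∈ =
    toWitness (Equivalence.from BoolP.T-≡ (trans (sym (VecP.lookup∘tabulate _ x)) (∈⇒lookup x∈)))

-- Coroot cones and upper sets

module _ {n : ℕ} where

  IsUpperSet : Rel n → Subset n → Set
  IsUpperSet R A = ∀ {a b} → R a b → b ∈ A → a ∈ A

  upper? : ∀ {R} → Decidable R → ∀ A → Dec (IsUpperSet R A)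
  upper? R? A = map′ (λ up Rab b∈A → up _ _ Rab b∈A) (λ up a b → up)
    (FinP.all? λ a → FinP.all? λ b → R? a b →-dec (b SubP.∈? A →-dec a SubP.∈? A))

  ∩-upper : ∀ {R A B} → IsUpperSet R A → IsUpperSet R B → IsUpperSet R (A ∩ B)
  ∩-upper {A = A} {B} upA upB Rab b∈A∩B =
    let (b∈A , b∈B) = SubP.x∈p∩q⁻ A B b∈A∩B in SubP.x∈p∩q⁺ (upA Rab b∈A , upB Rab b∈B)

  ∪-upper : ∀ {R A B} → IsUpperSet R A → IsUpperSet R B → IsUpperSet R (A ∪ B)
  ∪-upper {A = A} {B} upA upB Rab b∈A∪B =
    SubP.x∈p∪q⁺ (Sum.map (upA Rab) (upB Rab) (SubP.x∈p∪q⁻ A B b∈A∪B))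

  NonnegOnUpperSets : Rel n → Pt n → Set
  NonnegOnUpperSets R h = ∀ A → IsUpperSet R A → 0ℚ ≤ sumOn A h

  coroot-on-upper : ∀ {R : Rel n} {A a b} → IsUpperSet R A → R a b →
    sumOn A (coroot a b) ≡ 0ℚ ⊎ (a ∈ A × b ∉ A × sumOn A (coroot a b) ≡ 1ℚ)
  coroot-on-upper {A = A} {a} {b} up Rab rewrite sumOn-coroot A a b with a SubP.∈? A | b SubP.∈? A
  ... | yes a∈A | yes b∈A rewrite ∈⇒lookup a∈A | ∈⇒lookup b∈A = inj₁ refl
  ... | yes a∈A | no  b∉A rewrite ∈⇒lookup a∈A | ∉⇒lookup b∉A = inj₂ (a∈A , b∉A , refl)
  ... | no  a∉A | yes b∈A = contradiction (up Rab b∈A) a∉A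
  ... | no  a∉A | no  b∉A rewrite ∉⇒lookup a∉A | ∉⇒lookup b∉A = inj₁ refl

  InCone⇒nonneg : ∀ {R : Rel n} {h} → InCone R h → NonnegOnUpperSets R h
  InCone⇒nonneg {R} {h} (k , as , bs , cs , ok , h≡Σ) A up =
    subst (0ℚ ≤_) (sym sumOn-h) (ΣF-nonneg k (λ t → generator-nonneg (ok t)))
    where
    sumOn-h : sumOn A h ≡ ΣF k (λ t → cs t * sumOn A (coroot (as t) (bs t)))
    sumOn-h = trans (sumOn-cong A h≡Σ) (trans (sumOn-ΣF A k _) (ΣF-cong k (λ t → sumOn-*ˡ A (cs t) _)))
    generator-nonneg : ∀ {a b c} → R a b × a ≢ b × 0ℚ ≤ c → 0ℚ ≤ c * sumOn A (coroot a b)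
    generator-nonneg {a} {b} {c} (Rab , _ , c≥0) with coroot-on-upper up Rab
    ... | inj₁ e           rewrite e = ℚP.≤-reflexive (sym (ℚP.*-zeroʳ c))
    ... | inj₂ (_ , _ , e) rewrite e = subst (0ℚ ≤_) (sym (ℚP.*-identityʳ c)) c≥0

  InCone-zero : ∀ {R : Rel n} {h : Pt n} → (∀ x → h x ≡ 0ℚ) → InCone R h
  InCone-zero h≡0 = 0 , (λ ()) , (λ ()) , (λ ()) , (λ ()) , h≡0

  InCone-mono : ∀ {R Q : Rel n} {h : Pt n} → (∀ {a b} → R a b → Q a b) → InCone R h → InCone Q h
  InCone-mono R⇒Q (k , as , bs , cs , ok , h≡Σ) =
    k , as , bs , cs , (λ t → let (r , a≢b , c≥0) = ok t in R⇒Q r , a≢b , c≥0) , h≡Σ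

-- Gale's criterion

module _ {n : ℕ} where

  push : Pt n → ℚ → Fin n → Fin n → Pt n
  push h c i j x = h x - c * coroot i j x

  InCone-push : ∀ {R : Rel n} {h c i j} → 0ℚ ≤ c → R i j → i ≢ j → InCone R (push h c i j) → InCone R h
  InCone-push {R} {h} {c} {i} {j} c≥0 Rij i≢j (k , as , bs , cs , ok , h′≡Σ) =
    suc k , cons i as , cons j bs , cons c cs , ok′ , h≡Σ
    where
    open ℚSolver.+-*-Solver
    cons : ∀ {X : Set} → X → (Fin k → X) → Fin (suc k) → X
    cons x xs zero    = x
    cons x xs (suc t) = xs t
    ok′ : ∀ t → R (cons i as t) (cons j bs t) × cons i as t ≢ cons j bs t × 0ℚ ≤ cons c cs t
    ok′ zero    = Rij , i≢j , c≥0
    ok′ (suc t) = ok t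
    h≡Σ : ∀ x → h x ≡ c * coroot i j x + ΣF k (λ t → cs t * coroot (as t) (bs t) x)
    h≡Σ x = trans (regroup (h x) (c * coroot i j x)) (cong (c * coroot i j x +_) (h′≡Σ x))
      where regroup = solve 2 (λ hx d → hx := d :+ (hx :- d)) refl

  sumOn-push : ∀ A h c i j → sumOn A (push h c i j) ≡ sumOn A h - c * sumOn A (coroot i j)
  sumOn-push A h c i j = trans (sumOn-- A h _) (cong (_-_ (sumOn A h)) (sumOn-*ˡ A c (coroot i j)))

  ΣF-push : ∀ h c i j → ΣF n h ≡ 0ℚ → ΣF n (push h c i j) ≡ 0ℚ
  ΣF-push h c i j Σh≡0 = begin
    ΣF n (push h c i j)                      ≡⟨ ΣF-- n h _ ⟩
    ΣF n h - ΣF n (λ x → c * coroot i j x)   ≡⟨ cong₂ _-_ Σh≡0 (trans (ΣF-*ˡ n c _)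
                                                                    (cong (c *_) (ΣF-coroot i j))) ⟩
    0ℚ - c * 0ℚ                              ≡⟨ cong (_-_ 0ℚ) (ℚP.*-zeroʳ c) ⟩
    0ℚ                                       ∎
    where open ≡-Reasoning

  push-source : ∀ h c {i j} → i ≢ j → push h c i j i ≡ h i - c
  push-source h c {i} {j} i≢j rewrite δ-diag i | δ-off (≢-sym i≢j) =
    cong (_-_ (h i)) (ℚP.*-identityʳ c)

  push-target : ∀ h c {i j} → i ≢ j → push h c i j j ≡ h j + c
  push-target h c {i} {j} i≢j rewrite δ-diag j | δ-off i≢j =
    solve 2 (λ a c → a :- c :* (con 0ℚ :- con 1ℚ) := a :+ c) refl (h j) c
    where open ℚSolver.+-*-Solver

  push-elsewhere : ∀ h c {i j x} → i ≢ x → j ≢ x → push h c i j x ≡ h x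
  push-elsewhere h c {i} {j} {x} i≢x j≢x rewrite δ-off i≢x | δ-off j≢x =
    trans (cong (_-_ (h x)) (ℚP.*-zeroʳ c)) (ℚP.+-identityʳ (h x))

  Separating : Rel n → Fin n → Fin n → Subset n → Set
  Separating R i j A = IsUpperSet R A × i ∈ A × j ∉ A

  separating? : ∀ {R : Rel n} → Decidable R → ∀ i j A → Dec (Separating R i j A)
  separating? R? i j A = upper? R? A ×-dec i SubP.∈? A ×-dec ¬? (j SubP.∈? A)

  push-nonneg : ∀ {R : Rel n} {h c i j} → NonnegOnUpperSets R h → R i j →
    (∀ A → Separating R i j A → c ≤ sumOn A h) → NonnegOnUpperSets R (push h c i j)
  push-nonneg {R} {h} {c} {i} {j} h≥0 Rij bound A up rewrite sumOn-push A h c i j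
    with coroot-on-upper up Rij
  ... | inj₁ e rewrite e =
    subst (0ℚ ≤_) (sym (trans (cong (_-_ (sumOn A h)) (ℚP.*-zeroʳ c)) (ℚP.+-identityʳ (sumOn A h))))
      (h≥0 A up)
  ... | inj₂ (i∈A , j∉A , e) rewrite e | ℚP.*-identityʳ c =
    subst (_≤ sumOn A h - c) (ℚP.+-inverseʳ c) (ℚP.+-monoˡ-≤ (- c) (bound A (up , i∈A , j∉A)))

  support : Pt n → Subset n
  support h = decSubset (λ x → ¬? (h x ℚP.≟ 0ℚ))

  ∈-support⁺ : ∀ h {x} → h x ≢ 0ℚ → x ∈ support h
  ∈-support⁺ h = ∈-decSubset⁺ (λ x → ¬? (h x ℚP.≟ 0ℚ))

  ∈-support⁻ : ∀ h {x} → x ∈ support h → h x ≢ 0ℚ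
  ∈-support⁻ h = ∈-decSubset⁻ (λ x → ¬? (h x ℚP.≟ 0ℚ))

  push-support-⊂ : ∀ {h c i j} → i ≢ j → h i ≢ 0ℚ → h j ≢ 0ℚ → c ≡ h i ⊎ c ≡ - h j →
    support (push h c i j) ⊂ support h
  push-support-⊂ {h} {c} {i} {j} i≢j hi≢0 hj≢0 c≡ = shrinks , strictly c≡
    where
    nonzero : ∀ {x} → push h c i j x ≢ 0ℚ → h x ≢ 0ℚ
    nonzero {x} h′x≢0 = byCases (i FinP.≟ x) (j FinP.≟ x)
      where
      byCases : Dec (i ≡ x) → Dec (j ≡ x) → h x ≢ 0ℚ
      byCases (yes refl) _          = hi≢0
      byCases (no _)     (yes refl) = hj≢0
      byCases (no i≢x)   (no j≢x)   = h′x≢0 ∘ trans (push-elsewhere h c i≢x j≢x)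
    shrinks : support (push h c i j) ⊆ support h
    shrinks x∈ = ∈-support⁺ h (nonzero (∈-support⁻ (push h c i j) x∈))
    vanishes : ∀ {x} → push h c i j x ≡ 0ℚ → x ∉ support (push h c i j)
    vanishes h′x≡0 x∈ = ∈-support⁻ (push h c i j) x∈ h′x≡0
    strictly : c ≡ h i ⊎ c ≡ - h j → ∃ λ x → x ∈ support h × x ∉ support (push h c i j)
    strictly (inj₁ refl) = i , ∈-support⁺ h hi≢0 ,
      vanishes (trans (push-source h c i≢j) (ℚP.+-inverseʳ (h i)))
    strictly (inj₂ refl) = j , ∈-support⁺ h hj≢0 ,
      vanishes (trans (push-target h c i≢j) (ℚP.+-inverseʳ (h j)))

argmin-Subset : ∀ {n} (P : Subset n → Set) → (∀ A → Dec (P A)) → (g : Subset n → ℚ) →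
  (∀ A → ¬ P A) ⊎ ∃ λ X → P X × ∀ A → P A → g X ≤ g A
argmin-Subset {zero} P P? g with P? []
... | yes p = inj₂ ([] , p , λ { [] _ → ℚP.≤-refl })
... | no ¬p = inj₁ λ { [] → ¬p }
argmin-Subset {suc n} P P? g
  with argmin-Subset (P ∘ (true ∷_)) (P? ∘ (true ∷_)) (g ∘ (true ∷_))
     | argmin-Subset (P ∘ (false ∷_)) (P? ∘ (false ∷_)) (g ∘ (false ∷_))
... | inj₁ none₁ | inj₁ none₀ = inj₁ λ { (true ∷ A) → none₁ A ; (false ∷ A) → none₀ A }
... | inj₂ (X , p , min) | inj₁ none₀ =
  inj₂ (true ∷ X , p , λ { (true ∷ A) q → min A q ; (false ∷ A) q → contradiction q (none₀ A) })
... | inj₁ none₁ | inj₂ (X , p , min) =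
  inj₂ (false ∷ X , p , λ { (true ∷ A) q → contradiction q (none₁ A) ; (false ∷ A) q → min A q })
... | inj₂ (X₁ , p₁ , min₁) | inj₂ (X₀ , p₀ , min₀) with ℚP.≤-total (g (true ∷ X₁)) (g (false ∷ X₀))
...   | inj₁ ≤₀ = inj₂ (true ∷ X₁ , p₁ ,
          λ { (true ∷ A) q → min₁ A q ; (false ∷ A) q → ℚP.≤-trans ≤₀ (min₀ A q) })
...   | inj₂ ≤₁ = inj₂ (false ∷ X₀ , p₀ ,
          λ { (true ∷ A) q → ℚP.≤-trans ≤₁ (min₁ A q) ; (false ∷ A) q → min₀ A q })

bounded-or-minimiser : ∀ {n} (P : Subset n → Set) → (∀ A → Dec (P A)) → (g : Subset n → ℚ) (c : ℚ) →
  (∀ A → P A → c ≤ g A) ⊎ ∃ λ X → P X × g X < c × ∀ A → P A → g X ≤ g A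
bounded-or-minimiser P P? g c with argmin-Subset P P? g
... | inj₁ none = inj₁ λ A p → contradiction p (none A)
... | inj₂ (X , p , min) with c ℚP.≤? g X
...   | yes c≤gX = inj₁ λ A q → ℚP.≤-trans c≤gX (min A q)
...   | no  c≰gX = inj₂ (X , p , ℚP.≰⇒> c≰gX , min)

module _ {n : ℕ} where

  cut : Rel n → Subset n → Rel n
  cut R X a b = R a b × (a ∈ X → b ∈ X)

  cut-isDecPreorder : ∀ {R} X → IsDecPreorder _≡_ R → IsDecPreorder _≡_ (cut R X)
  cut-isDecPreorder X pre = record
    { isPreorder = record
      { isEquivalence = ≡.isEquivalence
      ; reflexive     = λ { refl → ≲-refl , id }
      ; trans         = λ (Rab , ab) (Rbc , bc) → ≲-trans Rab Rbc , bc ∘ ab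
      }
    ; _≟_  = FinP._≟_
    ; _≲?_ = λ a b → a ≲? b ×-dec (a SubP.∈? X →-dec b SubP.∈? X)
    }
    where open IsDecPreorder pre using (_≲?_) renaming (refl to ≲-refl; trans to ≲-trans)

  cut-nonneg : ∀ {R X h} → IsUpperSet R X → sumOn X h ≡ 0ℚ →
    NonnegOnUpperSets R h → NonnegOnUpperSets (cut R X) h
  cut-nonneg {R} {X} {h} upX ΣX≡0 h≥0 B upB =
    subst (0ℚ ≤_) splitting (ℚP.+-mono-≤ (h≥0 (B ∩ X) up-∩) (h≥0 (B ∪ X) up-∪))
    where
    up-∩ : IsUpperSet R (B ∩ X)
    up-∩ Rab b∈B∩X with SubP.x∈p∩q⁻ B X b∈B∩X
    ... | b∈B , b∈X = SubP.x∈p∩q⁺ (upB (Rab , λ _ → b∈X) b∈B , upX Rab b∈X)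
    up-∪ : IsUpperSet R (B ∪ X)
    up-∪ {a} Rab b∈B∪X with SubP.x∈p∪q⁻ B X b∈B∪X | a SubP.∈? X
    ... | _        | yes a∈X = SubP.x∈p∪q⁺ (inj₂ a∈X)
    ... | inj₁ b∈B | no  a∉X = SubP.x∈p∪q⁺ (inj₁ (upB (Rab , λ a∈X → contradiction a∈X a∉X) b∈B))
    ... | inj₂ b∈X | no  a∉X = contradiction (upX Rab b∈X) a∉X
    splitting : sumOn (B ∩ X) h + sumOn (B ∪ X) h ≡ sumOn B h
    splitting = begin
      sumOn (B ∩ X) h + sumOn (B ∪ X) h  ≡⟨ sumOn-∩-∪ B X h ⟩
      sumOn B h + sumOn X h              ≡⟨ cong (sumOn B h +_) ΣX≡0 ⟩
      sumOn B h + 0ℚ                     ≡⟨ ℚP.+-identityʳ (sumOn B h) ⟩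
      sumOn B h                          ∎
      where open ≡-Reasoning

  -- The arcs of R, the arc (a , b) being encoded as combine a b : Fin (n * n).
  graph : ∀ {R : Rel n} → IsDecPreorder _≡_ R → Subset (n *ℕ n)
  graph pre = decSubset (λ k → uncurry (IsDecPreorder._≲?_ pre) (remQuot n k))

  graph-cut-⊂ : ∀ {R i j X} (pre : IsDecPreorder _≡_ R) → R i j → i ∈ X → j ∉ X →
    graph (cut-isDecPreorder X pre) ⊂ graph pre
  graph-cut-⊂ {R} {i} {j} {X} pre Rij i∈X j∉X =
    (λ k∈ → ∈-decSubset⁺ arc? (proj₁ (∈-decSubset⁻ cutArc? k∈))) ,
    combine i j ,
    ∈-decSubset⁺ arc? (subst (uncurry R) (sym (FinP.remQuot-combine i j)) Rij) ,
    λ ij∈ → j∉X (proj₂ (subst (uncurry (cut R X)) (FinP.remQuot-combine i j)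
                               (∈-decSubset⁻ cutArc? ij∈)) i∈X)
    where
    arc?    = λ k → uncurry (IsDecPreorder._≲?_ pre) (remQuot n k)
    cutArc? = λ k → uncurry (IsDecPreorder._≲?_ (cut-isDecPreorder X pre)) (remQuot n k)

  positive-above : ∀ {R : Rel n} {h j} → IsDecPreorder _≡_ R → NonnegOnUpperSets R h → h j < 0ℚ →
    ∃ λ i → R i j × 0ℚ < h i
  positive-above {R} {h} {j} pre h≥0 hj<0
    with FinP.any? (λ i → IsDecPreorder._≲?_ pre i j ×-dec 0ℚ ℚP.<? h i)
  ... | yes found = found
  ... | no  none  = contradiction Σ<0 (≤⇒≯ (h≥0 above-j upper))
    where
    open IsDecPreorder pre using (_≲?_) renaming (refl to ≲-refl; trans to ≲-trans)
    above? = λ x → x ≲? j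
    above-j = decSubset above?
    upper : IsUpperSet R above-j
    upper Rab b∈ = ∈-decSubset⁺ above? (≲-trans Rab (∈-decSubset⁻ above? b∈))
    term : Fin n → ℚ
    term x = if lookup above-j x then h x else 0ℚ
    term≤0 : ∀ x → term x ≤ 0ℚ
    term≤0 x with lookup above-j x in eq
    ... | true  = ℚP.≮⇒≥ λ 0<hx → none (x , ∈-decSubset⁻ above? (VecP.lookup⇒[]= x above-j eq) , 0<hx)
    ... | false = ℚP.≤-refl
    termj<0 : term j < 0ℚ
    termj<0 rewrite ∈⇒lookup (∈-decSubset⁺ above? (≲-refl {j})) = hj<0
    Σ<0 : sumOn above-j h < 0ℚ
    Σ<0 = subst (sumOn above-j h <_) (ΣF-0 n) (ΣF-mono-< n term≤0 j termj<0)

  opposite-signs⇒≢ : ∀ {h : Pt n} {i j} → 0ℚ < h i → h j < 0ℚ → i ≢ j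
  opposite-signs⇒≢ hi>0 hj<0 refl = ℚP.<-asym hi>0 hj<0

  ConeCriterion : Rel n → Pt n → Set
  ConeCriterion R h = InT h → NonnegOnUpperSets R h → InCone R h

  -- Push as much as possible from a positive coordinate i down to a negative j ≤ i: either a
  -- coordinate vanishes (the support shrinks), or an upper set X separating i from j becomes
  -- tight, and then the arcs leaving X can be cut without losing a constraint (the graph shrinks).
  cone-criterion-step : ∀ {R : Rel n} (pre : IsDecPreorder _≡_ R) h →
    (∀ h′ → support h′ ⊂ support h → ConeCriterion R h′) →
    (∀ {R′} (pre′ : IsDecPreorder _≡_ R′) → graph pre′ ⊂ graph pre → ∀ h′ → ConeCriterion R′ h′) →
    ConeCriterion R h
  cone-criterion-step {R} pre h smaller-support smaller-graph Σh≡0 h≥0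
    with FinP.any? (λ j → h j ℚP.<? 0ℚ)
  ... | no no-negative =
    InCone-zero {R = R} (ΣF-nonneg-zero n (λ x → ℚP.≮⇒≥ (λ hx<0 → no-negative (x , hx<0))) Σh≡0)
  ... | yes (j , hj<0) with positive-above pre h≥0 hj<0
  ...   | i , Rij , hi>0
    with bounded-or-minimiser (Separating R i j) (separating? (IsDecPreorder._≲?_ pre) i j)
                              (λ A → sumOn A h) (h i ⊓ - h j)
  ...     | inj₁ bounded = InCone-push {R = R} c≥0 Rij i≢j
    (smaller-support (push h c i j)
      (push-support-⊂ i≢j (ℚP.<⇒≢ hi>0 ∘ sym) (ℚP.<⇒≢ hj<0) (ℚP.⊓-sel (h i) (- h j)))
      (ΣF-push h c i j Σh≡0) (push-nonneg h≥0 Rij bounded))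
    where
    c = h i ⊓ - h j
    c≥0 : 0ℚ ≤ c
    c≥0 = ℚP.⊓-glb (ℚP.<⇒≤ hi>0) (ℚP.<⇒≤ (ℚP.neg-antimono-< hj<0))
    i≢j = opposite-signs⇒≢ hi>0 hj<0
  ...     | inj₂ (X , (upX , i∈X , j∉X) , _ , minimal) = InCone-push {R = R} (h≥0 X upX) Rij i≢j
    (InCone-mono {R = cut R X} proj₁
      (smaller-graph (cut-isDecPreorder X pre) (graph-cut-⊂ pre Rij i∈X j∉X) (push h m i j)
        (ΣF-push h m i j Σh≡0) (cut-nonneg upX tight (push-nonneg h≥0 Rij minimal))))
    where
    m = sumOn X h
    i≢j = opposite-signs⇒≢ hi>0 hj<0
    tight : sumOn X (push h m i j) ≡ 0ℚ
    tight rewrite sumOn-push X h m i j | sumOn-coroot X i j | ∈⇒lookup i∈X | ∉⇒lookup j∉X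
      = trans (cong (_-_ m) (ℚP.*-identityʳ m)) (ℚP.+-inverseʳ m)

  cone-criterion-acc : ∀ {R : Rel n} (pre : IsDecPreorder _≡_ R) → Acc _⊂_ (graph pre) →
    ∀ h → Acc _⊂_ (support h) → ConeCriterion R h
  cone-criterion-acc pre (acc smaller-graph) h (acc smaller-support) =
    cone-criterion-step pre h
      (λ h′ ⊂h → cone-criterion-acc pre (acc smaller-graph) h′ (smaller-support ⊂h))
      (λ pre′ ⊂R h′ → cone-criterion-acc pre′ (smaller-graph ⊂R) h′ (⊂-wellFounded _))

  cone-criterion : ∀ {R : Rel n} → IsDecPreorder _≡_ R → ∀ h → ConeCriterion R h
  cone-criterion pre h = cone-criterion-acc pre (⊂-wellFounded _) h (⊂-wellFounded _)

-- Chambers in the cone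

opposite : Sgn → Sgn
opposite pos = neg
opposite neg = pos
opposite zer = zer

isZer : ∀ s → s ≡ zer ⊎ s ≢ zer
isZer zer = inj₁ refl
isZer pos = inj₂ λ ()
isZer neg = inj₂ λ ()

sgn-pos⇒>0 : ∀ {q} → sgn q ≡ pos → 0ℚ < q
sgn-pos⇒>0 {mkℚ +[1+ _ ] _ _} _ = ℚP.positive⁻¹ _

sgn-zer⇒≡0 : ∀ {q} → sgn q ≡ zer → q ≡ 0ℚ
sgn-zer⇒≡0 {q@(mkℚ +0 _ _)} _ = ℚP.↥p≡0⇒p≡0 q refl

0≤⇒sgn≢neg : ∀ {q} → 0ℚ ≤ q → sgn q ≢ neg
0≤⇒sgn≢neg {q@(mkℚ -[1+ _ ] _ _)} 0≤q _ = ≤⇒≯ 0≤q (ℚP.negative⁻¹ q)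
0≤⇒sgn≢neg {mkℚ +0       _ _} _ ()
0≤⇒sgn≢neg {mkℚ +[1+ _ ] _ _} _ ()

zer-or-pos⇒≥0 : ∀ {q} → sgn q ≡ zer ⊎ sgn q ≡ pos → 0ℚ ≤ q
zer-or-pos⇒≥0 (inj₁ q≈0) = ℚP.≤-reflexive (sym (sgn-zer⇒≡0 q≈0))
zer-or-pos⇒≥0 (inj₂ q>0) = ℚP.<⇒≤ (sgn-pos⇒>0 q>0)

sgn-neg : ∀ q → sgn (- q) ≡ opposite (sgn q)
sgn-neg (mkℚ +0       _ _) = refl
sgn-neg (mkℚ +[1+ _ ] _ _) = refl
sgn-neg (mkℚ -[1+ _ ] _ _) = refl

module _ {n : ℕ} where

  NP-∁ : ∀ {A : Subset n} → NP A → NP (∁ A)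
  NP-∁ ((x , x∈A) , ∁A≢∅) = ∁A≢∅ , (x , SubP.x∉p⇒x∈∁p (SubP.x∈p⇒x∉∁p x∈A))

  sign-∁ : ∀ {X : SignVec n} {h A} → InFace X h → NP A → X (∁ A) ≡ opposite (X A)
  sign-∁ {X} {h} {A} (Σh≡0 , signs) npA = begin
    X (∁ A)                      ≡⟨ signs (∁ A) (NP-∁ npA) ⟨
    sgn (sumOn (∁ A) h)          ≡⟨ cong sgn (sumOn-∁-InT A Σh≡0) ⟩
    sgn (- sumOn A h)            ≡⟨ sgn-neg (sumOn A h) ⟩
    opposite (sgn (sumOn A h))   ≡⟨ cong opposite (signs A npA) ⟩
    opposite (X A)               ∎
    where open ≡-Reasoning

  closure-sign : ∀ {Y X : SignVec n} {A} → IsFace Y → InClosureOf Y X → NP A → Y A ≢ zer → X A ≡ Y A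
  closure-sign {Y} {X} {A} (y , y∈Y) Y⊆X̄ npA YA≢zer with proj₂ (Y⊆X̄ y y∈Y) A npA
  ... | inj₁ vanishing = contradiction (trans (sym (proj₂ y∈Y A npA)) vanishing) YA≢zer
  ... | inj₂ same      = trans (sym same) (proj₂ y∈Y A npA)

  PositiveOnUpperSets : Rel n → SignVec n → Set
  PositiveOnUpperSets R X = ∀ A → NP A → IsUpperSet R A → X A ≡ pos

  face-nonneg : ∀ {R X} {h : Pt n} → InFace X h → PositiveOnUpperSets R X → NonnegOnUpperSets R h
  face-nonneg {R} {X} {h} (Σh≡0 , signs) X>0 A upA with SubP.nonempty? A | SubP.nonempty? (∁ A)
  ... | no  A≡∅ | _ rewrite SubP.Empty-unique A≡∅ = ℚP.≤-reflexive (sym (sumOn-⊥ h))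
  ... | yes _   | no ∁A≡∅ = ℚP.≤-reflexive (sym (begin
    sumOn A h                   ≡⟨ ℚP.+-identityʳ (sumOn A h) ⟨
    sumOn A h + 0ℚ              ≡⟨ cong (sumOn A h +_) (sumOn-⊥ h) ⟨
    sumOn A h + sumOn ⊥ h       ≡⟨ cong (λ B → sumOn A h + sumOn B h) (SubP.Empty-unique ∁A≡∅) ⟨
    sumOn A h + sumOn (∁ A) h   ≡⟨ sumOn-∁ A h ⟩
    ΣF n h                      ≡⟨ Σh≡0 ⟩
    0ℚ                          ∎))
    where open ≡-Reasoning
  ... | yes A≢∅ | yes ∁A≢∅ = ℚP.<⇒≤ (sgn-pos⇒>0 (trans (signs A npA) (X>0 A npA upA)))
    where npA = A≢∅ , ∁A≢∅

  chamberInCone⇔positive : ∀ {R : Rel n} {X} → IsDecPreorder _≡_ R → IsChamber X →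
    ChamberInCone R X ⇔ PositiveOnUpperSets R X
  chamberInCone⇔positive {R} {X} pre ((h , h∈X) , X≢zer) = mk⇔ to from
    where
    to : ChamberInCone R X → PositiveOnUpperSets R X
    to X⊆cone A npA upA with X A in XA
    ... | pos = refl
    ... | zer = contradiction XA (X≢zer A npA)
    ... | neg = contradiction (trans (proj₂ h∈X A npA) XA)
                  (0≤⇒sgn≢neg (InCone⇒nonneg (X⊆cone h h∈X) A upA))
    from : PositiveOnUpperSets R X → ChamberInCone R X
    from X>0 h′ h′∈X = cone-criterion pre h′ (proj₁ h′∈X) (face-nonneg h′∈X X>0)

-- The face Y and its special sets

half : ∀ {n} → Subset n → Bool → Subset n
half A true  = A
half A false = ∁ A

signed : Bool → Bool → Bool
signed true  b = b
signed false b = not b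

lookup-half : ∀ {n} (A : Subset n) s x → lookup (half A s) x ≡ signed s (lookup A x)
lookup-half A true  x = refl
lookup-half A false x = VecP.lookup-map x not A

∈-half⇒lookup : ∀ {n} {A : Subset n} s {x} → x ∈ half A s → lookup A x ≡ s
∈-half⇒lookup true  = ∈⇒lookup
∈-half⇒lookup false = ∉⇒lookup ∘ SubP.x∈∁p⇒x∉p

∈-half-not : ∀ {n} {A : Subset n} s {x} → x ∈ half A (not s) → x ∉ half A s
∈-half-not true  = SubP.x∈∁p⇒x∉p
∈-half-not false = SubP.x∈p⇒x∉∁p

half-sign-cong : ∀ {n} {X X′ : SignVec n} {h h′ A} → InFace X h → InFace X′ h′ → NP A →
  X A ≡ X′ A → ∀ s → X (half A s) ≡ X′ (half A s)
half-sign-cong _  _   _   XA≡X′A true  = XA≡X′A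
half-sign-cong hX hX′ npA XA≡X′A false =
  trans (sign-∁ hX npA) (trans (cong opposite XA≡X′A) (sym (sign-∁ hX′ npA)))

lookup-ext : ∀ {n} {A B : Subset n} → (∀ x → lookup A x ≡ lookup B x) → A ≡ B
lookup-ext {A = A} {B} A≗B =
  trans (sym (VecP.tabulate∘lookup A)) (trans (VecP.tabulate-cong A≗B) (VecP.tabulate∘lookup B))

𝟙-cancel : ∀ a b → 𝟙 a - 𝟙 b ≡ 0ℚ → a ≡ b
𝟙-cancel true  true  _ = refl
𝟙-cancel false false _ = refl

Corners : Set
Corners = Bool × Bool × Bool × Bool

cornersOf : (Bool → Bool → Bool) → Corners
cornersOf f = f true true , f true false , f false true , f false false

alternating : Corners → ℚ
alternating (a , b , c , d) = (𝟙 a - 𝟙 b) - (𝟙 c - 𝟙 d)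

alternating-quadrant≢0 : ∀ s u → alternating (cornersOf (λ s′ u′ → signed s s′ ∧ signed u u′)) ≢ 0ℚ
alternating-quadrant≢0 true  true  ()
alternating-quadrant≢0 true  false ()
alternating-quadrant≢0 false true  ()
alternating-quadrant≢0 false false ()

-- half S false and half U false are the sets T and V of the paper.
module CodimTwoFace {n : ℕ} (S U : Subset n) (quadrant : ∀ s u → Nonempty (half S s ∩ half U u))
                    (Y : SignVec n) (span : SpanIsHH Y S U) where

  InPlane : Pt n → Set
  InPlane z = InT z × sumOn S z ≡ 0ℚ × sumOn U z ≡ 0ℚ

  Vanishes : Subset n → Set
  Vanishes C = ∀ y → InFace Y y → sumOn C y ≡ 0ℚ

  face⊆plane : ∀ {y} → InFace Y y → InPlane y
  face⊆plane {y} y∈Y = Equivalence.to (span y)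
    (1 , (λ _ → y) , (λ _ → 1ℚ) , (λ _ → y∈Y) ,
     λ x → sym (trans (ℚP.+-identityʳ _) (ℚP.*-identityˡ (y x))))

  vanishes-on-plane : ∀ C {z} → Vanishes C → InPlane z → sumOn C z ≡ 0ℚ
  vanishes-on-plane C {z} vanC z∈plane with Equivalence.from (span z) z∈plane
  ... | k , ys , cs , ys∈Y , z≡Σ = begin
    sumOn C z                                    ≡⟨ sumOn-cong C z≡Σ ⟩
    sumOn C (λ x → ΣF k (λ j → cs j * ys j x))   ≡⟨ sumOn-ΣF C k _ ⟩
    ΣF k (λ j → sumOn C (λ x → cs j * ys j x))   ≡⟨ ΣF-cong k (λ j → sumOn-*ˡ C (cs j) (ys j)) ⟩
    ΣF k (λ j → cs j * sumOn C (ys j))           ≡⟨ ΣF-cong k (λ j → cong (cs j *_) (vanC (ys j) (ys∈Y j))) ⟩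
    ΣF k (λ j → cs j * 0ℚ)                       ≡⟨ ΣF-cong k (λ j → ℚP.*-zeroʳ (cs j)) ⟩
    ΣF k (λ _ → 0ℚ)                              ≡⟨ ΣF-0 k ⟩
    0ℚ                                           ∎
    where open ≡-Reasoning

  vanishes-half-S : ∀ s → Vanishes (half S s)
  vanishes-half-S true  y y∈Y = proj₁ (proj₂ (face⊆plane y∈Y))
  vanishes-half-S false y y∈Y = let (Σy≡0 , ΣSy≡0 , _) = face⊆plane y∈Y in
    trans (sumOn-∁-InT S Σy≡0) (cong -_ ΣSy≡0)

  vanishes-half-U : ∀ u → Vanishes (half U u)
  vanishes-half-U true  y y∈Y = proj₂ (proj₂ (face⊆plane y∈Y))
  vanishes-half-U false y y∈Y = let (Σy≡0 , _ , ΣUy≡0) = face⊆plane y∈Y in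
    trans (sumOn-∁-InT U Σy≡0) (cong -_ ΣUy≡0)

  rep : Bool → Bool → Fin n
  rep s u = proj₁ (quadrant s u)

  rep∈quadrant : ∀ s u → rep s u ∈ half S s × rep s u ∈ half U u
  rep∈quadrant s u = SubP.x∈p∩q⁻ (half S s) (half U u) (proj₂ (quadrant s u))

  np-S : NP S
  np-S = (rep true true , proj₁ (rep∈quadrant true true)) ,
         (rep false true , proj₁ (rep∈quadrant false true))

  np-U : NP U
  np-U = (rep true true , proj₂ (rep∈quadrant true true)) ,
         (rep true false , proj₂ (rep∈quadrant true false))

  lookup-S-rep : ∀ s u → lookup S (rep s u) ≡ s
  lookup-S-rep s u = ∈-half⇒lookup s (proj₁ (rep∈quadrant s u))

  lookup-U-rep : ∀ s u → lookup U (rep s u) ≡ u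
  lookup-U-rep s u = ∈-half⇒lookup u (proj₂ (rep∈quadrant s u))

  coroot-in-plane : ∀ {x x′} → lookup S x ≡ lookup S x′ → lookup U x ≡ lookup U x′ → InPlane (coroot x x′)
  coroot-in-plane {x} {x′} Sx≡Sx′ Ux≡Ux′ = ΣF-coroot x x′ , balanced S Sx≡Sx′ , balanced U Ux≡Ux′
    where
    balanced : ∀ A → lookup A x ≡ lookup A x′ → sumOn A (coroot x x′) ≡ 0ℚ
    balanced A Ax≡Ax′ = trans (sumOn-coroot A x x′)
      (trans (cong (λ b → 𝟙 b - 𝟙 (lookup A x′)) Ax≡Ax′) (ℚP.+-inverseʳ (𝟙 (lookup A x′))))

  quadrant-constant : ∀ C {x x′} → Vanishes C → lookup S x ≡ lookup S x′ → lookup U x ≡ lookup U x′ →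
    lookup C x ≡ lookup C x′
  quadrant-constant C {x} {x′} vanC Sx≡Sx′ Ux≡Ux′ = 𝟙-cancel (lookup C x) (lookup C x′)
    (trans (sym (sumOn-coroot C x x′)) (vanishes-on-plane C vanC (coroot-in-plane Sx≡Sx′ Ux≡Ux′)))

  -- A vanishing set is a union of quadrants, so it is determined by these four memberships.
  corners : Subset n → Corners
  corners C = cornersOf (λ s u → lookup C (rep s u))

  corners-of : ∀ C f → (∀ s u → lookup C (rep s u) ≡ f s u) → corners C ≡ cornersOf f
  corners-of C f at =
    cong₂ _,_ (at true true) (cong₂ _,_ (at true false) (cong₂ _,_ (at false true) (at false false)))

  vanishing-lookup : ∀ C → Vanishes C → ∀ f → corners C ≡ cornersOf f →
    ∀ x → lookup C x ≡ f (lookup S x) (lookup U x)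
  vanishing-lookup C vanC f corners≡ x =
    trans (quadrant-constant C vanC (sym (lookup-S-rep s u)) (sym (lookup-U-rep s u))) (at-corner s u)
    where
    s = lookup S x
    u = lookup U x
    at-corner : ∀ s u → lookup C (rep s u) ≡ f s u
    at-corner true  true  = cong proj₁ corners≡
    at-corner true  false = cong (proj₁ ∘ proj₂) corners≡
    at-corner false true  = cong (proj₁ ∘ proj₂ ∘ proj₂) corners≡
    at-corner false false = cong (proj₂ ∘ proj₂ ∘ proj₂) corners≡

  p₁₁ p₁₀ p₀₁ p₀₀ : Fin n
  p₁₁ = rep true true
  p₁₀ = rep true false
  p₀₁ = rep false true
  p₀₀ = rep false false

  probe : Pt n
  probe x = coroot p₁₁ p₁₀ x - coroot p₀₁ p₀₀ x

  sumOn-probe : ∀ C → sumOn C probe ≡ alternating (corners C)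
  sumOn-probe C = trans (sumOn-- C _ _) (cong₂ _-_ (sumOn-coroot C _ _) (sumOn-coroot C _ _))

  probe-in-plane : InPlane probe
  probe-in-plane =
    trans (ΣF-- n (coroot p₁₁ p₁₀) (coroot p₀₁ p₀₀)) (cong₂ _-_ (ΣF-coroot p₁₁ p₁₀) (ΣF-coroot p₀₁ p₀₀)) ,
    trans (sumOn-probe S) (cong alternating (corners-of S (λ s _ → s) lookup-S-rep)) ,
    trans (sumOn-probe U) (cong alternating (corners-of U (λ _ u → u) lookup-U-rep))

  vanishing-alternating : ∀ C → Vanishes C → alternating (corners C) ≡ 0ℚ
  vanishing-alternating C vanC = trans (sym (sumOn-probe C)) (vanishes-on-plane C vanC probe-in-plane)

  Special : Subset n → Set
  Special C = ∃ λ s → C ≡ half S s ⊎ C ≡ half U s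

  vanishing⇒special : ∀ {C} → NP C → Vanishes C → Special C
  vanishing⇒special {C} ((x , x∈C) , (x′ , x′∈∁C)) vanC =
    classify (corners C) refl (vanishing-alternating C vanC)
    where
    along : ∀ f → corners C ≡ cornersOf f → ∀ y → lookup C y ≡ f (lookup S y) (lookup U y)
    along = vanishing-lookup C vanC
    classify : ∀ cs → corners C ≡ cs → alternating cs ≡ 0ℚ → Special C
    classify (true  , true  , false , false) eq _ = true  , inj₁ (lookup-ext (along (λ s _ → s) eq))
    classify (false , false , true  , true ) eq _ = false , inj₁ (lookup-ext λ y →
      trans (along (λ s _ → not s) eq y) (sym (lookup-half S false y)))
    classify (true  , false , true  , false) eq _ = true  , inj₂ (lookup-ext (along (λ _ u → u) eq))
    classify (false , true  , false , true ) eq _ = false , inj₂ (lookup-ext λ y →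
      trans (along (λ _ u → not u) eq y) (sym (lookup-half U false y)))
    classify (false , false , false , false) eq _ =
      contradiction (trans (sym (∈⇒lookup x∈C)) (along (λ _ _ → false) eq x)) λ ()
    classify (true  , true  , true  , true ) eq _ =
      contradiction (trans (sym (along (λ _ _ → true) eq x′)) (∉⇒lookup (SubP.x∈∁p⇒x∉p x′∈∁C))) λ ()
    classify (true  , true  , true  , false) _ ()
    classify (true  , true  , false , true ) _ ()
    classify (true  , false , true  , true ) _ ()
    classify (true  , false , false , true ) _ ()
    classify (true  , false , false , false) _ ()
    classify (false , true  , true  , true ) _ ()
    classify (false , true  , true  , false) _ ()
    classify (false , true  , false , false) _ ()
    classify (false , false , true  , false) _ ()
    classify (false , false , false , true ) _ ()

  quadrant-not-vanishing : ∀ s u → ¬ Vanishes (half S s ∩ half U u)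
  quadrant-not-vanishing s u vanishes = alternating-quadrant≢0 s u
    (trans (cong alternating (sym corners-quadrant)) (vanishing-alternating Q vanishes))
    where
    Q = half S s ∩ half U u
    corners-quadrant : corners Q ≡ cornersOf (λ s′ u′ → signed s s′ ∧ signed u u′)
    corners-quadrant = corners-of Q _ λ s′ u′ →
      trans (VecP.lookup-zipWith _∧_ (rep s′ u′) (half S s) (half U u))
        (cong₂ _∧_ (trans (lookup-half S s _) (cong (signed s) (lookup-S-rep s′ u′)))
                   (trans (lookup-half U u _) (cong (signed u) (lookup-U-rep s′ u′))))

  sign-agree : ∀ {X X′ A} → IsFace Y → InClosureOf Y X → InClosureOf Y X′ → NP A →
    Special A ⊎ X A ≡ X′ A
  sign-agree {X} {X′} {A} faceY Y⊆X̄ Y⊆X̄′ npA with isZer (Y A)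
  ... | inj₁ YA≡zer =
    inj₁ (vanishing⇒special npA λ y y∈Y → sgn-zer⇒≡0 (trans (proj₂ y∈Y A npA) YA≡zer))
  ... | inj₂ YA≢zer =
    inj₂ (trans (closure-sign faceY Y⊆X̄ npA YA≢zer) (sym (closure-sign faceY Y⊆X̄′ npA YA≢zer)))

  positive-transfer : ∀ {R : Rel n} {X X′} → IsFace Y → InClosureOf Y X → InClosureOf Y X′ →
    (∀ A → Special A → NP A → IsUpperSet R A → X A ≡ X′ A) →
    PositiveOnUpperSets R X → PositiveOnUpperSets R X′
  positive-transfer faceY Y⊆X̄ Y⊆X̄′ special X>0 A npA upA with sign-agree faceY Y⊆X̄ Y⊆X̄′ npA
  ... | inj₁ sp     = trans (sym (special A sp npA upA)) (X>0 A npA upA)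
  ... | inj₂ XA≡X′A = trans (sym XA≡X′A) (X>0 A npA upA)

  no-positive-chamber : ∀ {R : Rel n} {X} s u → IsUpperSet R (half S s) → IsUpperSet R (half U u) →
    InClosureOf Y X → ¬ PositiveOnUpperSets R X
  no-positive-chamber {R} {X} s u upA upB Y⊆X̄ X>0 = quadrant-not-vanishing s u vanishes-∩
    where
    A = half S s
    B = half U u
    outer∉A : rep (not s) (not u) ∉ A
    outer∉A = ∈-half-not s (proj₁ (rep∈quadrant (not s) (not u)))
    outer∉B : rep (not s) (not u) ∉ B
    outer∉B = ∈-half-not u (proj₂ (rep∈quadrant (not s) (not u)))
    np-∩ : NP (A ∩ B)
    np-∩ = quadrant s u , (_ , SubP.x∉p⇒x∈∁p (outer∉A ∘ proj₁ ∘ SubP.x∈p∩q⁻ A B))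
    np-∪ : NP (A ∪ B)
    np-∪ = (_ , SubP.x∈p∪q⁺ (inj₁ (proj₁ (rep∈quadrant s u)))) ,
           (_ , SubP.x∉p⇒x∈∁p (Sum.[ outer∉A , outer∉B ] ∘ SubP.x∈p∪q⁻ A B))
    nonneg : ∀ C → NP C → IsUpperSet R C → ∀ y → InFace Y y → 0ℚ ≤ sumOn C y
    nonneg C npC upC y y∈Y =
      zer-or-pos⇒≥0 (Sum.map₂ (λ same → trans same (X>0 C npC upC)) (proj₂ (Y⊆X̄ y y∈Y) C npC))
    vanishes-∩ : Vanishes (A ∩ B)
    vanishes-∩ y y∈Y = nonneg-+-zero (nonneg (A ∩ B) np-∩ (∩-upper upA upB) y y∈Y)
      (nonneg (A ∪ B) np-∪ (∪-upper upA upB) y y∈Y)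
      (trans (sumOn-∩-∪ A B y) (cong₂ _+_ (vanishes-half-S s y y∈Y) (vanishes-half-U u y y∈Y)))

-- The Steinmann relations

module _ {n : ℕ} {R : Rel n} {v : SignVec n → ℤ} (pre : IsDecPreorder _≡_ R) (checkC : IsCheckC R v)
  where

  checkC-positive : ∀ {X} → IsChamber X → PositiveOnUpperSets R X → v X ≡ +[1+ 0 ]
  checkC-positive chamber X>0 =
    proj₁ (checkC _ chamber) (Equivalence.from (chamberInCone⇔positive pre chamber) X>0)

  checkC-not-positive : ∀ {X} → IsChamber X → ¬ PositiveOnUpperSets R X → v X ≡ +0
  checkC-not-positive chamber X≯0 =
    proj₂ (checkC _ chamber) (X≯0 ∘ Equivalence.to (chamberInCone⇔positive pre chamber))

  -- The goal is a decidable equation, so positivity of X may be decided classically.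
  checkC-cong : ∀ {X X′} → IsChamber X → IsChamber X′ →
    (PositiveOnUpperSets R X → PositiveOnUpperSets R X′) →
    (PositiveOnUpperSets R X′ → PositiveOnUpperSets R X) → v X ≡ v X′
  checkC-cong {X} {X′} chamber chamber′ to from =
    decidable-stable (v X ℤP.≟ v X′) (¬¬-map byCases ¬¬-excluded-middle)
    where
    byCases : Dec (PositiveOnUpperSets R X) → v X ≡ v X′
    byCases (yes X>0) = trans (checkC-positive chamber X>0) (sym (checkC-positive chamber′ (to X>0)))
    byCases (no  X≯0) =
      trans (checkC-not-positive chamber X≯0) (sym (checkC-not-positive chamber′ (X≯0 ∘ from)))

module AroundFace {n : ℕ} {R : Rel n} {v : SignVec n → ℤ}
                  (pre : IsDecPreorder _≡_ R) (checkC : IsCheckC R v)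
                  (S U : Subset n) (quadrant : ∀ s u → Nonempty (half S s ∩ half U u))
                  (Y : SignVec n) (faceY : IsFace Y) (spanY : SpanIsHH Y S U) where
  open CodimTwoFace S U quadrant Y spanY public

  Agreement : SignVec n → SignVec n → Set
  Agreement X X′ = ∀ A → Special A → NP A → IsUpperSet R A → X A ≡ X′ A

  same-value : ∀ {X X′} → IsChamber X → IsChamber X′ → InClosureOf Y X → InClosureOf Y X′ →
    Agreement X X′ → v X ≡ v X′
  same-value chamber chamber′ Y⊆X̄ Y⊆X̄′ agree = checkC-cong pre checkC chamber chamber′
    (positive-transfer faceY Y⊆X̄ Y⊆X̄′ agree)
    (positive-transfer faceY Y⊆X̄′ Y⊆X̄ λ A sp np up → sym (agree A sp np up))

  agreement-off-S : ¬ (∃ λ s → IsUpperSet R (half S s)) → ∀ {X X′} → IsChamber X → IsChamber X′ →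
    X U ≡ X′ U → Agreement X X′
  agreement-off-S ¬upS _ _ _ _ (s , inj₁ refl) _ upA = ⊥-elim (¬upS (s , upA))
  agreement-off-S ¬upS ((_ , h∈X) , _) ((_ , h′∈X′) , _) XU≡X′U _ (u , inj₂ refl) _ _ =
    half-sign-cong h∈X h′∈X′ np-U XU≡X′U u

  agreement-off-U : ¬ (∃ λ u → IsUpperSet R (half U u)) → ∀ {X X′} → IsChamber X → IsChamber X′ →
    X S ≡ X′ S → Agreement X X′
  agreement-off-U ¬upU _ _ _ _ (u , inj₂ refl) _ upA = ⊥-elim (¬upU (u , upA))
  agreement-off-U ¬upU ((_ , h∈X) , _) ((_ , h′∈X′) , _) XS≡X′S _ (s , inj₁ refl) _ _ =
    half-sign-cong h∈X h′∈X′ np-S XS≡X′S s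

  zero-value : ∀ s u {X} → IsUpperSet R (half S s) → IsUpperSet R (half U u) →
    IsChamber X → InClosureOf Y X → v X ≡ +0
  zero-value s u upS upU chamber Y⊆X̄ =
    checkC-not-positive pre checkC chamber (no-positive-chamber s u upS upU Y⊆X̄)

∃-Bool? : ∀ {P : Bool → Set} → (∀ b → Dec (P b)) → Dec (∃ P)
∃-Bool? P? with P? true | P? false
... | yes p  | _      = yes (true , p)
... | no _   | yes p  = yes (false , p)
... | no ¬p₁ | no ¬p₀ = no λ { (true , p) → ¬p₁ p ; (false , p) → ¬p₀ p }

all-zero : ∀ {a b c d : ℤ} → a ≡ +0 → b ≡ +0 → c ≡ +0 → d ≡ +0 → ((a -ℤ b) -ℤ c) +ℤ d ≡ +0
all-zero refl refl refl refl = refl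

rows-cancel : ∀ {a b c d : ℤ} → a ≡ c → b ≡ d → ((a -ℤ b) -ℤ c) +ℤ d ≡ +0
rows-cancel {a} {b} refl refl = solve 2 (λ a b → ((a :- b) :- a) :+ b := con +0) refl a b
  where open ℤSolver.+-*-Solver

columns-cancel : ∀ {a b c d : ℤ} → a ≡ b → c ≡ d → ((a -ℤ b) -ℤ c) +ℤ d ≡ +0
columns-cancel {a} {c = c} refl refl = solve 2 (λ a c → ((a :- a) :- c) :+ c := con +0) refl a c
  where open ℤSolver.+-*-Solver

preposet-isDecPreorder : ∀ {n} (P : Preposet n) → Decidable (Preposet._≽_ P) →
  IsDecPreorder _≡_ (Preposet._≽_ P)
preposet-isDecPreorder P _≽?_ = record
  { isPreorder = record
    { isEquivalence = ≡.isEquivalence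
    ; reflexive     = λ { refl → refl′ _ }
    ; trans         = trans′
    }
  ; _≟_  = FinP._≟_
  ; _≲?_ = _≽?_
  }
  where open Preposet P

steinmann-decidable : ∀ {n} (P : Preposet n) → Decidable (Preposet._≽_ P) →
  ∀ v → IsCheckC (Preposet._≽_ P) v → Steinmann v
steinmann-decidable P _≽?_ v checkC S U S∩U S∩V T∩U T∩V Y faceY spanY Xpp Xpm Xmp Xmm
  cpp cpm cmp cmm Y⊆pp Y⊆pm Y⊆mp Y⊆mm ppS ppU pmS pmU mpS mpU mmS mmU =
  byCases (upper-half? S) (upper-half? U)
  where
  open Preposet P using (_≽_)
  quadrant : ∀ s u → Nonempty (half S s ∩ half U u)
  quadrant true  true  = S∩U
  quadrant true  false = S∩V
  quadrant false true  = T∩U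
  quadrant false false = T∩V
  open AroundFace (preposet-isDecPreorder P _≽?_) checkC S U quadrant Y faceY spanY
  upper-half? : ∀ A → Dec (∃ λ s → IsUpperSet _≽_ (half A s))
  upper-half? A = ∃-Bool? (λ s → upper? _≽?_ (half A s))
  byCases : Dec (∃ λ s → IsUpperSet _≽_ (half S s)) → Dec (∃ λ u → IsUpperSet _≽_ (half U u)) →
    ((v Xpp -ℤ v Xpm) -ℤ v Xmp) +ℤ v Xmm ≡ +0
  byCases (yes (s , upS)) (yes (u , upU)) = all-zero
    (zero-value s u upS upU cpp Y⊆pp) (zero-value s u upS upU cpm Y⊆pm)
    (zero-value s u upS upU cmp Y⊆mp) (zero-value s u upS upU cmm Y⊆mm)
  byCases (no ¬upS) _ = rows-cancel
    (same-value cpp cmp Y⊆pp Y⊆mp (agreement-off-S ¬upS cpp cmp (trans ppU (sym mpU))))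
    (same-value cpm cmm Y⊆pm Y⊆mm (agreement-off-S ¬upS cpm cmm (trans pmU (sym mmU))))
  byCases (yes _) (no ¬upU) = columns-cancel
    (same-value cpp cpm Y⊆pp Y⊆pm (agreement-off-U ¬upU cpp cpm (trans ppS (sym pmS))))
    (same-value cmp cmm Y⊆mp Y⊆mm (agreement-off-U ¬upU cmp cmm (trans mpS (sym mmS))))

¬¬-Π-Fin : ∀ {n} {P : Fin n → Set} → (∀ i → ¬ ¬ P i) → ¬ ¬ (∀ i → P i)
¬¬-Π-Fin {zero}  _   ¬all = ¬all λ ()
¬¬-Π-Fin {suc n} ¬¬P ¬all =
  ¬¬P zero λ p₀ → ¬¬-Π-Fin (¬¬P ∘ suc) λ ps → ¬all λ { zero → p₀ ; (suc i) → ps i }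

¬¬-decidable : ∀ {n} (R : Rel n) → ¬ ¬ Decidable R
¬¬-decidable R = ¬¬-Π-Fin λ i → ¬¬-Π-Fin λ j → ¬¬-excluded-middle

-- The preposet need not be decidable, but the conclusion is an equation in ℤ,
-- so decidability of the preposet may be assumed classically.
steinmann : ∀ {n} (P : Preposet n) v → IsCheckC (Preposet._≽_ P) v → Steinmann v
steinmann P v checkC S U S∩U S∩V T∩U T∩V Y faceY spanY Xpp Xpm Xmp Xmm
  cpp cpm cmp cmm Y⊆pp Y⊆pm Y⊆mp Y⊆mm ppS ppU pmS pmU mpS mpU mmS mmU =
  decidable-stable (_ ℤP.≟ +0) (¬¬-map alternating-sum (¬¬-decidable _))
  where
  alternating-sum : Decidable (Preposet._≽_ P) → _
  alternating-sum _≽?_ = steinmann-decidable P _≽?_ v checkC S U S∩U S∩V T∩U T∩V Y faceY spanY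
    Xpp Xpm Xmp Xmm cpp cpm cmp cmm Y⊆pp Y⊆pm Y⊆mp Y⊆mm ppS ppU pmS pmU mpS mpU mmS mmU

compositionPreposet : ∀ {n} → Composition n → Preposet n
compositionPreposet F = record { _≽_ = compRel F ; refl′ = reflexive ; trans′ = transitive }
  where
  open Composition F
  reflexive : ∀ i → compRel F i i
  reflexive i = let (a , i∈a) = covers i in a , a , FinP.≤-refl , i∈a , i∈a
  transitive : ∀ {i j k} → compRel F i j → compRel F j k → compRel F i k
  transitive {j = j} (a , b , a≤b , i∈a , j∈b) (b′ , c , b′≤c , j∈b′ , k∈c) with b FinP.≟ b′
  ... | yes refl = a , c , FinP.≤-trans a≤b b′≤c , i∈a , k∈c
  ... | no  b≢b′ = contradiction j∈b′ (disjoint b b′ b≢b′ j j∈b)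

mainTheorem10 :
    ((n : ℕ) (F : Composition n) (v : SignVec n → ℤ) →
      IsCheckC (compRel F) v → Steinmann v)
    ×
    ((n : ℕ) (p : Preposet n) (v : SignVec n → ℤ) →
      IsCheckC (Preposet._≽_ p) v → Steinmann v)
mainTheorem10 = (λ n F → steinmann (compositionPreposet F)) , (λ n → steinmann)
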